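{- Let $p>2$ be prime. Then the set $S=\{(x,y)\in\mathbb F_p^2:\ \nu(y)<\nu(x)\}$ of points of $\mathrm{AG}(2,p)$ has exactly 3 special directions.
   Context: $\nu:\mathbb F_p\to\mathbb Z$ maps an element to its representative in $\{0,\dots,p-1\}$. Lines of $\mathrm{AG}(2,p)$ with slope $d\in\mathbb F_p$ are $Y=dX+b$, with slope $\infty$ are $X+b=0$. A direction $d\in\mathbb F_p\cup\{\infty\}$ is special for $S$ if not every line of slope $d$ contains $\lfloor|S|/p\rfloor$ or $\lceil|S|/p\rceil$ points of $S$. -}

module Defs where

open import Data.Nat using (ℕ; zero; suc; _+_; _*_; _∸_; NonZero; _<ᵇ_; _/_)
open import Data.Nat.DivMod using (m%n<n)
import Data.Nat
open import Data.Fin using (Fin; toℕ; fromℕ<)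
import Data.Fin as F
open import Data.Bool using (Bool; if_then_else_)
open import Data.Maybe using (Maybe; just; nothing)
open import Data.Sum using (_⊎_)
open import Relation.Binary.PropositionalEquality using (_≡_)
open import Relation.Nullary using (¬_)

sumF : ∀ {n} → (Fin n → ℕ) → ℕ
sumF {zero}  f = 0
sumF {suc n} f = f F.zero + sumF {n} (λ i → f (F.suc i))

countF : ∀ {n} → (Fin n → Bool) → ℕ
countF f = sumF (λ i → if f i then 1 else 0)

-- The prime field F_p is modelled as Fin p with arithmetic mod p.
-- ν : F_p → ℤ (representative in {0,…,p-1}) is toℕ.
module _ (p : ℕ) {{_ : NonZero p}} where

  ofℕ : ℕ → Fin p
  ofℕ n = fromℕ< (m%n<n n p)

  addF : Fin p → Fin p → Fin p
  addF a b = ofℕ (toℕ a + toℕ b)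

  mulF : Fin p → Fin p → Fin p
  mulF a b = ofℕ (toℕ a * toℕ b)

  negF : Fin p → Fin p
  negF a = ofℕ (p ∸ toℕ a)

  inS : Fin p → Fin p → Bool
  inS x y = toℕ y <ᵇ toℕ x

  sizeS : ℕ
  sizeS = sumF (λ x → countF (λ y → inS x y))

  -- Directions: just d is slope d ∈ F_p, nothing is slope ∞.
  Direction : Set
  Direction = Maybe (Fin p)

  -- number of points of S on the line of direction dir with parameter b:
  --   slope d : Y = dX + b ;  slope ∞ : X + b = 0
  lineCount : Direction → Fin p → ℕ
  lineCount (just d) b = countF (λ x → inS x (addF (mulF d x) b))
  lineCount nothing  b = countF (λ y → inS (negF b) y)

  floorS ceilS : ℕ
  floorS = sizeS / p
  ceilS  = (sizeS + (p ∸ 1)) / p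

  Special : Direction → Set
  Special dir = ¬ (∀ (b : Fin p) → (lineCount dir b ≡ floorS) ⊎ (lineCount dir b ≡ ceilS))

module Submission where

-- Write p = 2k + 1. Then |S| = Σₓ ν(x) = pk, so ⌊|S|/p⌋ = ⌈|S|/p⌉ = k and a direction is special
-- iff one of its lines does not meet S in exactly k points. The lines X = 0, Y = −1 and Y = X
-- miss S, so ∞, 0 and 1 are special. For any other slope d, the points y = dx + b satisfy
-- ν(y − x) + ν(x) = ν(y) + p·[ν(y) < ν(x)]; summing over x, and using that x ↦ dx + b and
-- x ↦ (d − 1)x + b permute F_p, gives p·|S ∩ line| = Σₓ ν(x) = pk.

open import Defs
open import Data.Nat using (ℕ; zero; suc; _+_; _*_; _∸_; _<_; _≤_; z≤n; s≤s; NonZero; _<ᵇ_; _%_; _/_; >-nonZero⁻¹; nonTrivial⇒n>1)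
open import Data.Nat.Properties
open import Data.Nat.DivMod
open import Data.Nat.Divisibility using (_∣_; divides; >⇒∤; m%n≡0⇒n∣m; n∣m⇒m%n≡0; n∣m*n)
open import Data.Nat.Primality using (Prime; euclidsLemma; composite; prime⇒¬composite; prime⇒nonTrivial)
open import Data.Nat.Solver using (module +-*-Solver)
open import Algebra.Properties.Semiring.Sum +-*-semiring using (sum; sum-syntax; sum-cong-≗; ∑-distrib-+; *-distribˡ-sum; ∑-permute)
open import Data.Fin using (Fin; toℕ; punchOut)
import Data.Fin as F
open import Data.Fin.Properties using (toℕ-fromℕ<; toℕ-injective; toℕ<n; punchOut-injective; injective⇒≤; any?)
open import Data.Fin.Permutation using (Permutation)
open import Data.Bool using (Bool; true; false; if_then_else_)
open import Data.Bool.Properties using (T-≡; ¬-not)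
open import Data.Maybe using (just; nothing)
open import Data.Maybe.Properties using (just-injective)
open import Data.Product using (Σ; ∃; _×_; _,_; proj₁; proj₂)
open import Data.Sum using (_⊎_; inj₁; inj₂)
open import Function using (_∘_)
open import Function.Bundles using (_⇔_; mk⇔; mk↔ₛ′; Equivalence)
open import Function.Definitions using (Injective)
open import Relation.Binary.PropositionalEquality
open import Relation.Nullary using (¬_; Dec; yes; no; contradiction)
open +-*-Solver using (solve; _:+_; _:*_; _:=_; con)

indicator : Bool → ℕ
indicator b = if b then 1 else 0

sumF≡∑ : ∀ {n} (f : Fin n → ℕ) → sumF f ≡ ∑[ i < n ] f i
sumF≡∑ {zero}  f = refl
sumF≡∑ {suc n} f = cong (f F.zero +_) (sumF≡∑ (f ∘ F.suc))

sumF-cong : ∀ {n} {f g : Fin n → ℕ} → (∀ i → f i ≡ g i) → sumF f ≡ sumF g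
sumF-cong {zero}  f≗g = refl
sumF-cong {suc n} f≗g = cong₂ _+_ (f≗g F.zero) (sumF-cong (f≗g ∘ F.suc))

countF-true : ∀ {n} → countF {n} (λ _ → true) ≡ n
countF-true {zero}  = refl
countF-true {suc n} = cong suc (countF-true {n})

countF-false : ∀ {n} → countF {n} (λ _ → false) ≡ 0
countF-false {zero}  = refl
countF-false {suc n} = countF-false {n}

countF-toℕ<ᵇ : ∀ {n m} → m ≤ n → countF {n} (λ i → toℕ i <ᵇ m) ≡ m
countF-toℕ<ᵇ {zero}  {zero}  z≤n       = refl
countF-toℕ<ᵇ {suc n} {zero}  z≤n       = countF-false {n}
countF-toℕ<ᵇ {suc n} {suc m} (s≤s m≤n) = cong suc (countF-toℕ<ᵇ m≤n)

countF-<ᵇtoℕ : ∀ {n} m → countF {n} (λ i → m <ᵇ toℕ i) ≡ n ∸ suc m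
countF-<ᵇtoℕ {zero}  m       = refl
countF-<ᵇtoℕ {suc n} zero    = countF-true {n}
countF-<ᵇtoℕ {suc n} (suc m) = countF-<ᵇtoℕ {n} m

∑-suc : ∀ {n} (f : Fin n → ℕ) → ∑[ i < n ] suc (f i) ≡ n + ∑[ i < n ] f i
∑-suc {zero}  f = refl
∑-suc {suc n} f = cong suc (begin
  f F.zero + ∑[ i < n ] suc (f (F.suc i))   ≡⟨ cong (f F.zero +_) (∑-suc (f ∘ F.suc)) ⟩
  f F.zero + (n + ∑[ i < n ] f (F.suc i))   ≡⟨ solve 3 (λ a m s → a :+ (m :+ s) := m :+ (a :+ s)) refl (f F.zero) n _ ⟩
  n + (f F.zero + ∑[ i < n ] f (F.suc i))   ∎)
  where open ≡-Reasoning

gauss : ∀ n → 2 * ∑[ i < n ] toℕ i + n ≡ n * n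
gauss zero    = refl
gauss (suc n) = begin
  2 * ∑[ i < n ] suc (toℕ i) + suc n   ≡⟨ cong (λ s → 2 * s + suc n) (∑-suc {n} toℕ) ⟩
  2 * (n + T) + suc n                 ≡⟨ solve 2 (λ m t → con 2 :* (m :+ t) :+ (con 1 :+ m) := con 2 :* t :+ m :+ (con 1 :+ con 2 :* m)) refl n T ⟩
  2 * T + n + suc (2 * n)             ≡⟨ cong (_+ suc (2 * n)) (gauss n) ⟩
  n * n + suc (2 * n)                 ≡⟨ solve 1 (λ m → m :* m :+ (con 1 :+ con 2 :* m) := (con 1 :+ m) :* (con 1 :+ m)) refl n ⟩
  suc n * suc n                       ∎
  where
  open ≡-Reasoning
  T = ∑[ i < n ] toℕ i

-- Pigeonhole: missing y, f would inject Fin (suc n) into Fin n.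
injective⇒surjective : ∀ {n} {f : Fin n → Fin n} → Injective _≡_ _≡_ f → ∀ y → ∃ λ x → f x ≡ y
injective⇒surjective {suc n} {f} f-inj y with any? (λ x → f x F.≟ y)
... | yes hit = hit
... | no miss = contradiction (injective⇒≤ g-inj) (<-irrefl refl)
  where
  g : Fin (suc n) → Fin n
  g x = punchOut (λ y≡fx → miss (x , sym y≡fx))
  g-inj : Injective _≡_ _≡_ g
  g-inj {x} {x′} gx≡gx′ = f-inj (punchOut-injective (miss ∘ (x ,_) ∘ sym) (miss ∘ (x′ ,_) ∘ sym) gx≡gx′)

injective⇒permutation : ∀ {n} {f : Fin n → Fin n} → Injective _≡_ _≡_ f → Permutation n n
injective⇒permutation {f = f} f-inj =
  mk↔ₛ′ f (proj₁ ∘ onto) (proj₂ ∘ onto) (λ x → f-inj (proj₂ (onto (f x))))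
  where onto = injective⇒surjective f-inj

∑-reindex : ∀ {n} {σ : Fin n → Fin n} → Injective _≡_ _≡_ σ →
            (f : Fin n → ℕ) → ∑[ i < n ] f (σ i) ≡ ∑[ i < n ] f i
∑-reindex σ-inj f = sym (∑-permute f (injective⇒permutation σ-inj))

<ᵇ-true : ∀ {m n} → m < n → (m <ᵇ n) ≡ true
<ᵇ-true m<n = Equivalence.to T-≡ (<⇒<ᵇ m<n)

<ᵇ-false : ∀ {m n} → n ≤ m → (m <ᵇ n) ≡ false
<ᵇ-false {m} {n} n≤m = ¬-not (λ m<ᵇn → ≤⇒≯ n≤m (<ᵇ⇒< m n (Equivalence.from T-≡ m<ᵇn)))

%-carry : ∀ {d r x} .{{_ : NonZero d}} → r < d → x < d →
          r + x ≡ (r + x) % d + d * indicator ((r + x) % d <ᵇ x)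
%-carry {d} {r} {x} r<d x<d = by-cases (r + x <? d)
  where
  open ≡-Reasoning
  carried : ℕ → ℕ
  carried y = y + d * indicator (y <ᵇ x)
  by-cases : Dec (r + x < d) → r + x ≡ carried ((r + x) % d)
  by-cases (yes r+x<d) = begin
    r + x                               ≡⟨ +-identityʳ (r + x) ⟨
    r + x + 0                           ≡⟨ cong (r + x +_) (*-zeroʳ d) ⟨
    r + x + d * 0                       ≡⟨ cong (λ b → r + x + d * indicator b) (<ᵇ-false (m≤n+m x r)) ⟨
    carried (r + x)                     ≡⟨ cong carried (m<n⇒m%n≡m r+x<d) ⟨
    carried ((r + x) % d)               ∎
  by-cases (no r+x≮d) = begin
    r + x                               ≡⟨ m∸n+n≡m d≤r+x ⟨
    w + d                               ≡⟨ cong (w +_) (*-identityʳ d) ⟨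
    w + d * 1                           ≡⟨ cong (λ b → w + d * indicator b) (<ᵇ-true w<x) ⟨
    carried w                           ≡⟨ cong carried w≡[r+x]%d ⟩
    carried ((r + x) % d)               ∎
    where
    d≤r+x = ≮⇒≥ r+x≮d
    w = r + x ∸ d
    w<x : w < x
    w<x = subst (w <_) (m+n∸m≡n d x) (∸-monoˡ-< (+-monoˡ-< x r<d) d≤r+x)
    w≡[r+x]%d : w ≡ (r + x) % d
    w≡[r+x]%d = trans (sym (m<n⇒m%n≡m (<-trans w<x x<d))) (m≤n⇒[n∸m]%m≡n%m d≤r+x)

[m%d+n]%d≡[m+n]%d : ∀ m n {d} .{{_ : NonZero d}} → (m % d + n) % d ≡ (m + n) % d
[m%d+n]%d≡[m+n]%d m n {d} = begin
  (m % d + n) % d          ≡⟨ %-distribˡ-+ (m % d) n d ⟩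
  (m % d % d + n % d) % d  ≡⟨ cong (λ r → (r + n % d) % d) (m%n%n≡m%n m d) ⟩
  (m % d + n % d) % d      ≡⟨ %-distribˡ-+ m n d ⟨
  (m + n) % d              ∎
  where open ≡-Reasoning

[m+n]%d≡m%d⇒d∣n : ∀ m n {d} .{{_ : NonZero d}} → (m + n) % d ≡ m % d → d ∣ n
[m+n]%d≡m%d⇒d∣n m n {d} eq = divides ((m + n) / d ∸ m / d) (begin
  n                                             ≡⟨ m+n∸m≡n m n ⟨
  m + n ∸ m                                     ≡⟨ cong₂ _∸_ (m≡m%n+[m/n]*n (m + n) d) (m≡m%n+[m/n]*n m d) ⟩
  (m + n) % d + (m + n) / d * d ∸ (m % d + m / d * d)
                                                ≡⟨ cong (λ r → r + (m + n) / d * d ∸ (m % d + m / d * d)) eq ⟩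
  m % d + (m + n) / d * d ∸ (m % d + m / d * d) ≡⟨ [m+n]∸[m+o]≡n∸o (m % d) _ _ ⟩
  (m + n) / d * d ∸ m / d * d                   ≡⟨ *-distribʳ-∸ d ((m + n) / d) (m / d) ⟨
  ((m + n) / d ∸ m / d) * d                     ∎)
  where open ≡-Reasoning

[m*n+o]/n≡m : ∀ m {n o} .{{_ : NonZero n}} → o < n → (m * n + o) / n ≡ m
[m*n+o]/n≡m m {n} {o} o<n = begin
  (m * n + o) / n    ≡⟨ +-distrib-/-∣ˡ o (n∣m*n m) ⟩
  m * n / n + o / n  ≡⟨ cong₂ _+_ (m*n/n≡m m n) (m<n⇒m/n≡0 o<n) ⟩
  m + 0              ≡⟨ +-identityʳ m ⟩
  m                  ∎
  where open ≡-Reasoning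

-- Euclid: p ∣ e (x ∸ y) with p ∤ e forces p ∣ x ∸ y < p.
affine-cancel : ∀ {p e c x y} .{{_ : NonZero p}} → Prime p → ¬ p ∣ e → y ≤ x → x < p →
                (e * x + c) % p ≡ (e * y + c) % p → x ≡ y
affine-cancel {p} {e} {c} {x} {y} p-prime p∤e y≤x x<p eq =
  ≤-antisym (m∸n≡0⇒m≤n (δ≡0 (euclidsLemma e δ p-prime p∣eδ))) y≤x
  where
  δ = x ∸ y
  shifted : e * x + c ≡ e * y + c + e * δ
  shifted = begin
    e * x + c            ≡⟨ cong (λ t → e * t + c) (m+[n∸m]≡n y≤x) ⟨
    e * (y + δ) + c      ≡⟨ solve 4 (λ e y δ c → e :* (y :+ δ) :+ c := e :* y :+ c :+ e :* δ) refl e y δ c ⟩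
    e * y + c + e * δ    ∎
    where open ≡-Reasoning
  p∣eδ : p ∣ e * δ
  p∣eδ = [m+n]%d≡m%d⇒d∣n (e * y + c) (e * δ) (trans (cong (_% p) (sym shifted)) eq)
  δ≡0 : p ∣ e ⊎ p ∣ δ → δ ≡ 0
  δ≡0 (inj₁ p∣e) = contradiction p∣e p∤e
  δ≡0 (inj₂ p∣δ) = trans (sym (m<n⇒m%n≡m (≤-<-trans (m∸n≤m x y) x<p))) (n∣m⇒m%n≡0 δ p p∣δ)

module AffinePlane (p : ℕ) {{_ : NonZero p}} where
  open ≡-Reasoning

  toℕ-ofℕ : ∀ m → toℕ (ofℕ p m) ≡ m % p
  toℕ-ofℕ m = toℕ-fromℕ< (m%n<n m p)

  toℕ-ofℕ-< : ∀ {m} → m < p → toℕ (ofℕ p m) ≡ m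
  toℕ-ofℕ-< m<p = trans (toℕ-ofℕ _) (m<n⇒m%n≡m m<p)

  toℕ-affine : ∀ d x b → toℕ (addF p (mulF p d x) b) ≡ (toℕ d * toℕ x + toℕ b) % p
  toℕ-affine d x b = begin
    toℕ (addF p (mulF p d x) b)                ≡⟨ toℕ-ofℕ _ ⟩
    (toℕ (mulF p d x) + toℕ b) % p             ≡⟨ cong (λ r → (r + toℕ b) % p) (toℕ-ofℕ _) ⟩
    ((toℕ d * toℕ x) % p + toℕ b) % p          ≡⟨ [m%d+n]%d≡[m+n]%d (toℕ d * toℕ x) (toℕ b) ⟩
    (toℕ d * toℕ x + toℕ b) % p                ∎

  p∸1<p : p ∸ 1 < p
  p∸1<p = m<n+o⇒m∸n<o p 1 (n<1+n p)

  zeroₚ oneₚ topₚ : Fin p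
  zeroₚ = ofℕ p 0
  oneₚ  = ofℕ p 1
  topₚ  = ofℕ p (p ∸ 1)

  toℕ-zeroₚ : toℕ zeroₚ ≡ 0
  toℕ-zeroₚ = toℕ-ofℕ-< (>-nonZero⁻¹ p)

  slope-cases : (s : Fin p) → s ≡ zeroₚ ⊎ s ≡ oneₚ ⊎ ∃ λ e → toℕ s ≡ suc (suc e)
  slope-cases s with toℕ s in s≡ | toℕ<n s
  ... | zero        | _   = inj₁ (toℕ-injective (trans s≡ (sym toℕ-zeroₚ)))
  ... | suc zero    | 1<p = inj₂ (inj₁ (toℕ-injective (trans s≡ (sym (toℕ-ofℕ-< 1<p)))))
  ... | suc (suc e) | _   = inj₂ (inj₂ (e , refl))

  sizeS≡∑toℕ : sizeS p ≡ ∑[ x < p ] toℕ x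
  sizeS≡∑toℕ = trans (sumF-cong {p} (λ x → countF-toℕ<ᵇ (<⇒≤ (toℕ<n x)))) (sumF≡∑ {p} toℕ)

  lineCount-slope : ∀ d b → lineCount p (just d) b ≡ countF {p} (λ x → (toℕ d * toℕ x + toℕ b) % p <ᵇ toℕ x)
  lineCount-slope d b = sumF-cong {p} (λ x → cong (λ y → indicator (y <ᵇ toℕ x)) (toℕ-affine d x b))

  lineCount-vertical : lineCount p nothing zeroₚ ≡ 0
  lineCount-vertical = begin
    lineCount p nothing zeroₚ  ≡⟨ countF-toℕ<ᵇ (<⇒≤ (toℕ<n (negF p zeroₚ))) ⟩
    toℕ (negF p zeroₚ)         ≡⟨ toℕ-ofℕ _ ⟩
    (p ∸ toℕ zeroₚ) % p        ≡⟨ cong (λ z → (p ∸ z) % p) toℕ-zeroₚ ⟩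
    p % p                      ≡⟨ n%n≡0 p ⟩
    0                          ∎

  lineCount-horizontal : lineCount p (just zeroₚ) topₚ ≡ 0
  lineCount-horizontal = begin
    lineCount p (just zeroₚ) topₚ  ≡⟨ lineCount-slope zeroₚ topₚ ⟩
    countF {p} (λ x → (toℕ zeroₚ * toℕ x + toℕ topₚ) % p <ᵇ toℕ x)
      ≡⟨ sumF-cong {p} (λ x → cong (λ y → indicator (y <ᵇ toℕ x)) (y≡p∸1 x)) ⟩
    countF {p} (λ x → p ∸ 1 <ᵇ toℕ x)  ≡⟨ countF-<ᵇtoℕ {p} (p ∸ 1) ⟩
    p ∸ suc (p ∸ 1)                ≡⟨ cong (p ∸_) (m+[n∸m]≡n (>-nonZero⁻¹ p)) ⟩
    p ∸ p                          ≡⟨ n∸n≡0 p ⟩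
    0                              ∎
    where
    y≡p∸1 : ∀ x → (toℕ zeroₚ * toℕ x + toℕ topₚ) % p ≡ p ∸ 1
    y≡p∸1 x rewrite toℕ-zeroₚ | toℕ-ofℕ-< p∸1<p = m<n⇒m%n≡m p∸1<p

  lineCount-diagonal : 1 < p → lineCount p (just oneₚ) zeroₚ ≡ 0
  lineCount-diagonal 1<p = begin
    lineCount p (just oneₚ) zeroₚ  ≡⟨ lineCount-slope oneₚ zeroₚ ⟩
    countF {p} (λ x → (toℕ oneₚ * toℕ x + toℕ zeroₚ) % p <ᵇ toℕ x)
      ≡⟨ sumF-cong {p} (λ x → cong indicator (<ᵇ-false (≤-reflexive (sym (y≡x x))))) ⟩
    countF {p} (λ _ → false)       ≡⟨ countF-false {p} ⟩
    0                              ∎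
    where
    y≡x : ∀ x → (toℕ oneₚ * toℕ x + toℕ zeroₚ) % p ≡ toℕ x
    y≡x x rewrite toℕ-ofℕ-< 1<p | toℕ-zeroₚ | +-identityʳ (toℕ x) | +-identityʳ (toℕ x) =
      m<n⇒m%n≡m (toℕ<n x)

  module _ (p-prime : Prime p) where

    ∑-affine : ∀ e c → ¬ p ∣ e → ∑[ x < p ] ((e * toℕ x + c) % p) ≡ ∑[ x < p ] toℕ x
    ∑-affine e c p∤e = begin
      ∑[ x < p ] ((e * toℕ x + c) % p)  ≡⟨ sum-cong-≗ {p} (λ x → toℕ-ofℕ (e * toℕ x + c)) ⟨
      ∑[ x < p ] toℕ (σ x)              ≡⟨ ∑-reindex σ-inj toℕ ⟩
      ∑[ x < p ] toℕ x                  ∎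
      where
      σ : Fin p → Fin p
      σ x = ofℕ p (e * toℕ x + c)
      σ-cancel : ∀ {x y} → toℕ y ≤ toℕ x → σ x ≡ σ y → x ≡ y
      σ-cancel {x} {y} y≤x σx≡σy = toℕ-injective (affine-cancel p-prime p∤e y≤x (toℕ<n x)
        (trans (sym (toℕ-ofℕ _)) (trans (cong toℕ σx≡σy) (toℕ-ofℕ _))))
      σ-inj : Injective _≡_ _≡_ σ
      σ-inj {x} {y} σx≡σy with ≤-total (toℕ y) (toℕ x)
      ... | inj₁ y≤x = σ-cancel y≤x σx≡σy
      ... | inj₂ x≤y = sym (σ-cancel x≤y (sym σx≡σy))

    p*count-carries : ∀ e c → suc (suc e) < p →
      p * countF {p} (λ x → (suc (suc e) * toℕ x + c) % p <ᵇ toℕ x) ≡ ∑[ x < p ] toℕ x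
    p*count-carries e c d<p = +-cancelˡ-≡ T _ _ (begin
      T + p * countF carry                          ≡⟨ cong₂ _+_ (sym (∑-affine d c p∤d)) (cong (p *_) (sumF≡∑ ι)) ⟩
      ∑[ x < p ] Y x + p * ∑[ x < p ] ι x           ≡⟨ cong (sum Y +_) (*-distribˡ-sum p ι) ⟩
      ∑[ x < p ] Y x + ∑[ x < p ] (p * ι x)         ≡⟨ ∑-distrib-+ Y (λ x → p * ι x) ⟨
      ∑[ x < p ] (Y x + p * ι x)                    ≡⟨ sum-cong-≗ {p} pointwise ⟨
      ∑[ x < p ] (Z x + toℕ x)                      ≡⟨ ∑-distrib-+ Z toℕ ⟩
      ∑[ x < p ] Z x + T                            ≡⟨ cong (_+ T) (∑-affine (suc e) c p∤e+1) ⟩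
      T + T                                         ∎)
      where
      d = suc (suc e)
      T = ∑[ x < p ] toℕ x
      Y Z : Fin p → ℕ
      Y x = (d * toℕ x + c) % p
      Z x = (suc e * toℕ x + c) % p
      carry : Fin p → Bool
      carry x = Y x <ᵇ toℕ x
      ι : Fin p → ℕ
      ι = indicator ∘ carry
      p∤d : ¬ p ∣ d
      p∤d = >⇒∤ d<p
      p∤e+1 : ¬ p ∣ suc e
      p∤e+1 = >⇒∤ (<-trans (n<1+n (suc e)) d<p)
      Z+x≡Y : ∀ x → (Z x + toℕ x) % p ≡ Y x
      Z+x≡Y x = trans ([m%d+n]%d≡[m+n]%d (suc e * toℕ x + c) (toℕ x))
        (cong (_% p) (solve 3 (λ e x c → (con 1 :+ e) :* x :+ c :+ x := (con 2 :+ e) :* x :+ c) refl e (toℕ x) c))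
      pointwise : ∀ x → Z x + toℕ x ≡ Y x + p * ι x
      pointwise x = trans (%-carry (m%n<n _ p) (toℕ<n x))
        (cong (λ y → y + p * indicator (y <ᵇ toℕ x)) (Z+x≡Y x))

    lineCount-balanced : ∀ d b {e} → toℕ d ≡ suc (suc e) → p * lineCount p (just d) b ≡ ∑[ x < p ] toℕ x
    lineCount-balanced d b {e} d≡ = begin
      p * lineCount p (just d) b                                  ≡⟨ cong (p *_) (lineCount-slope d b) ⟩
      p * countF {p} (λ x → (toℕ d * toℕ x + toℕ b) % p <ᵇ toℕ x)
        ≡⟨ cong (λ t → p * countF {p} (λ x → (t * toℕ x + toℕ b) % p <ᵇ toℕ x)) d≡ ⟩
      p * countF {p} (λ x → (suc (suc e) * toℕ x + toℕ b) % p <ᵇ toℕ x) ≡⟨ p*count-carries e (toℕ b) (subst (_< p) d≡ (toℕ<n d)) ⟩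
      ∑[ x < p ] toℕ x                                            ∎

odd-prime : ∀ {p} → Prime p → 2 < p → p ≡ suc (2 * (p / 2))
odd-prime {p} p-prime 2<p with p % 2 in p%2≡ | m%n<n p 2
... | 0           | _               = contradiction (composite 2<p (m%n≡0⇒n∣m p 2 p%2≡)) (prime⇒¬composite p-prime)
... | 1           | _               = trans (m≡m%n+[m/n]*n p 2) (cong₂ _+_ p%2≡ (*-comm (p / 2) 2))
... | suc (suc _) | s≤s (s≤s ())

module OddPrime (p k : ℕ) {{_ : NonZero p}} (p-prime : Prime p) (p≡1+2k : p ≡ suc (2 * k)) where
  open AffinePlane p
  open ≡-Reasoning

  1<p : 1 < p
  1<p = nonTrivial⇒n>1 p {{prime⇒nonTrivial p-prime}}

  k≢0 : k ≢ 0
  k≢0 k≡0 = <-irrefl (sym (trans p≡1+2k (cong (λ t → suc (2 * t)) k≡0))) 1<p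

  ∑toℕ≡p*k : ∑[ x < p ] toℕ x ≡ p * k
  ∑toℕ≡p*k = *-cancelˡ-≡ _ _ 2 (+-cancelʳ-≡ p _ _ (begin
    2 * ∑[ x < p ] toℕ x + p  ≡⟨ gauss p ⟩
    p * p                     ≡⟨ cong (p *_) p≡1+2k ⟩
    p * suc (2 * k)           ≡⟨ solve 2 (λ p k → p :* (con 1 :+ con 2 :* k) := con 2 :* (p :* k) :+ p) refl p k ⟩
    2 * (p * k) + p           ∎))

  sizeS≡k*p : sizeS p ≡ k * p
  sizeS≡k*p = trans sizeS≡∑toℕ (trans ∑toℕ≡p*k (*-comm p k))

  floorS≡k : floorS p ≡ k
  floorS≡k = trans (cong (_/ p) sizeS≡k*p) (m*n/n≡m k p)

  ceilS≡k : ceilS p ≡ k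
  ceilS≡k = trans (cong (λ s → (s + (p ∸ 1)) / p) sizeS≡k*p) ([m*n+o]/n≡m k p∸1<p)

  special-if-empty-line : ∀ dir b → lineCount p dir b ≡ 0 → Special p dir
  special-if-empty-line dir b empty balanced with balanced b
  ... | inj₁ ≡floor = k≢0 (trans (sym floorS≡k) (trans (sym ≡floor) empty))
  ... | inj₂ ≡ceil  = k≢0 (trans (sym ceilS≡k) (trans (sym ≡ceil) empty))

  ¬special-if-balanced : ∀ dir → (∀ b → lineCount p dir b ≡ k) → ¬ Special p dir
  ¬special-if-balanced dir ≡k special = special (λ b → inj₁ (trans (≡k b) (sym floorS≡k)))

  special-directions : ∀ dir → Special p dir ⇔ (dir ≡ nothing ⊎ dir ≡ just zeroₚ ⊎ dir ≡ just oneₚ)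
  special-directions dir = mk⇔ (classify dir) special
    where
    special : ∀ {dir} → dir ≡ nothing ⊎ dir ≡ just zeroₚ ⊎ dir ≡ just oneₚ → Special p dir
    special (inj₁ refl)        = special-if-empty-line nothing zeroₚ lineCount-vertical
    special (inj₂ (inj₁ refl)) = special-if-empty-line (just zeroₚ) topₚ lineCount-horizontal
    special (inj₂ (inj₂ refl)) = special-if-empty-line (just oneₚ) zeroₚ (lineCount-diagonal 1<p)
    classify : ∀ dir → Special p dir → dir ≡ nothing ⊎ dir ≡ just zeroₚ ⊎ dir ≡ just oneₚ
    classify nothing  _ = inj₁ refl
    classify (just s) s-special with slope-cases s
    ... | inj₁ refl               = inj₂ (inj₁ refl)
    ... | inj₂ (inj₁ refl)        = inj₂ (inj₂ refl)
    ... | inj₂ (inj₂ (e , s≡e+2)) = contradiction s-special (¬special-if-balanced (just s) (λ b →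
      *-cancelˡ-≡ _ _ p (trans (lineCount-balanced p-prime s b s≡e+2) ∑toℕ≡p*k)))

  zeroₚ≢oneₚ : zeroₚ ≢ oneₚ
  zeroₚ≢oneₚ eq = 0≢1+n (trans (sym toℕ-zeroₚ) (trans (cong toℕ eq) (toℕ-ofℕ-< 1<p)))

theorem6p2 : (p : ℕ) → Prime p → 2 < p → {{_ : NonZero p}} →
    Σ (Direction p) λ d₁ → Σ (Direction p) λ d₂ → Σ (Direction p) λ d₃ →
      (¬ d₁ ≡ d₂) × (¬ d₁ ≡ d₃) × (¬ d₂ ≡ d₃) ×
      ((d : Direction p) → Special p d ⇔ ((d ≡ d₁) ⊎ (d ≡ d₂) ⊎ (d ≡ d₃)))
theorem6p2 p p-prime 2<p =
  nothing , just zeroₚ , just oneₚ , (λ ()) , (λ ()) , zeroₚ≢oneₚ ∘ just-injective , special-directions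
  where
  open AffinePlane p
  open OddPrime p (p / 2) p-prime (odd-prime p-prime 2<p)
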